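{- The equation $2^r\cdot 3^s - 1 = y^n$ has no solution in positive integers $r,s,y,n$ with $y>1$ and $n>1$. -}

module Defs where

{-# OPTIONS --safe #-}

-- Since 6 divides y ^ n + 1, y ≡ 5 (mod 6); n cannot be even because −1 is not
-- a square modulo 3. For odd n = 2m + 1 ≥ 3 write y ^ n + 1 = (y + 1) Q with
-- Q = y ^ 2m − y ^ (2m − 1) + ⋯ + 1. Then Q is odd, Q ≡ n (mod 3), and Q divides
-- 2 ^ r 3 ^ s, so if 3 ∤ n then Q = 1, which is impossible. If 3 ∣ n, then
-- z = y ^ (n / 3) again satisfies z ≡ 5 (mod 6), say z = 5 + 6a, and
-- z ^ 3 + 1 = 18 (1 + a) Q′ where Q′ = 1 + 6 (1 + 3a + 2a²) > 1 is a divisor of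
-- 2 ^ r 3 ^ s coprime to 6.

module Submission where

open import Defs
open import Data.Nat using (ℕ; _+_; _*_; _^_; _<_; _≤_)
open import Relation.Binary.PropositionalEquality using (_≡_)
open import Relation.Nullary using (¬_)

open import Data.Nat using (zero; suc; NonZero; z<s; s<s)
open import Data.Nat.Properties
  using (*-identityˡ; *-identityʳ; *-assoc; +-comm; ^-*-assoc; <-irrefl)
open import Data.Nat.Divisibility
open import Data.Nat.DivMod using (_divMod_; result)
open import Data.Nat.Coprimality using (Coprime; coprime-divisor)
open import Data.Nat.Primality using (Prime; prime?; prime[2]; prime⇒irreducible)
open import Data.Nat.Tactic.RingSolver using (solve-∀)
open import Data.Fin using (zero; suc)
open import Data.Product using (∃-syntax; _,_)
open import Data.Sum using (inj₁; inj₂)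
open import Function using (_∘_)
open import Relation.Binary.PropositionalEquality
  using (refl; sym; trans; cong; subst; _≢_; module ≡-Reasoning)
open import Relation.Nullary using (yes; no; contradiction)
open import Relation.Nullary.Decidable using (from-yes)

∣m⇒∤o+m : ∀ {d m o} .{{_ : NonZero o}} → o < d → d ∣ m → d ∤ o + m
∣m⇒∤o+m {d} {m} {o} o<d d∣m d∣o+m =
  >⇒∤ o<d (∣m+n∣m⇒∣n (subst (d ∣_) (+-comm o m) d∣o+m) d∣m)

∣⇒∤^+1 : ∀ {d y} k → 1 < d → d ∣ y → d ∤ y ^ suc k + 1
∣⇒∤^+1 {d} {y} k 1<d d∣y =
  ∣m⇒∤o+m 1<d (∣m⇒∣m*n (y ^ k) d∣y) ∘ subst (d ∣_) (+-comm (y ^ suc k) 1)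

prime∤⇒coprime : ∀ {p w} → Prime p → p ∤ w → Coprime w p
prime∤⇒coprime p-prime p∤w (d∣w , d∣p) with prime⇒irreducible p-prime d∣p
... | inj₁ d≡1 = d≡1
... | inj₂ refl = contradiction d∣w p∤w

coprime-divisor-^ : ∀ {w p n} k → Coprime w p → w ∣ p ^ k * n → w ∣ n
coprime-divisor-^ {w} {n = n} zero c w∣ = subst (w ∣_) (*-identityˡ n) w∣
coprime-divisor-^ {w} {p} {n} (suc k) c w∣ =
  coprime-divisor-^ k c (coprime-divisor c (subst (w ∣_) (*-assoc p (p ^ k) n) w∣))

prime[3] : Prime 3
prime[3] = from-yes (prime? 3)

∣2^r*3^s⇒≡1 : ∀ {w} r s → 2 ∤ w → 3 ∤ w → w ∣ 2 ^ r * 3 ^ s → w ≡ 1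
∣2^r*3^s⇒≡1 {w} r s 2∤w 3∤w w∣ = ∣1⇒≡1
  (coprime-divisor-^ s (prime∤⇒coprime prime[3] 3∤w)
    (subst (w ∣_) (sym (*-identityʳ (3 ^ s)))
      (coprime-divisor-^ r (prime∤⇒coprime prime[2] 2∤w) w∣)))

6∣2^[1+r]*3^[1+s] : ∀ r s → 6 ∣ 2 ^ suc r * 3 ^ suc s
6∣2^[1+r]*3^[1+s] r s =
  *-pres-∣ {2} {2 ^ suc r} {3} {3 ^ suc s} (m∣m*n (2 ^ r)) (m∣m*n (3 ^ s))

^-≡1-mod : ∀ d c k → ∃[ e ] (1 + c * d) ^ k ≡ 1 + e * d
^-≡1-mod d c zero = 0 , refl
^-≡1-mod d c (suc k) with ^-≡1-mod d c k
... | e , eq = c + e + c * e * d , trans (cong ((1 + c * d) *_) eq) (product d c e)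
  where
  product : ∀ d c e → (1 + c * d) * (1 + e * d) ≡ 1 + (c + e + c * e * d) * d
  product = solve-∀

3∤x*x+1 : ∀ x → 3 ∤ x * x + 1
3∤x*x+1 x with x divMod 3
... | result q zero refl =
  ∣m⇒∤o+m (s<s z<s) (∣n⇒∣m*n (q * 3) (n∣m*n q)) ∘ subst (3 ∣_) (+-comm _ 1)
... | result q (suc zero) refl =
  ∣m⇒∤o+m (s<s (s<s z<s)) (n∣m*n (q * 2 + q * q * 3)) ∘ subst (3 ∣_) (square q)
  where
  square : ∀ q → (1 + q * 3) * (1 + q * 3) + 1 ≡ 2 + (q * 2 + q * q * 3) * 3
  square = solve-∀
... | result q (suc (suc zero)) refl =
  ∣m⇒∤o+m (s<s (s<s z<s)) (n∣m*n (1 + q * 4 + q * q * 3)) ∘ subst (3 ∣_) (square q)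
  where
  square : ∀ q → (2 + q * 3) * (2 + q * 3) + 1 ≡ 2 + (1 + q * 4 + q * q * 3) * 3
  square = solve-∀

6∣y^[1+k]+1⇒y≡5-mod-6 : ∀ y k → 6 ∣ y ^ suc k + 1 → ∃[ a ] y ≡ 5 + a * 6
6∣y^[1+k]+1⇒y≡5-mod-6 y k 6∣ =
  residue (∣-trans (divides 3 refl) 6∣) (∣-trans (divides 2 refl) 6∣)
  where
  residue : 2 ∣ y ^ suc k + 1 → 3 ∣ y ^ suc k + 1 → ∃[ a ] y ≡ 5 + a * 6
  residue 2∣ 3∣ with y divMod 6
  ... | result a zero refl =
    contradiction 2∣ (∣⇒∤^+1 k (s<s z<s) (∣n⇒∣m*n a (divides 3 refl)))
  ... | result a (suc (suc zero)) refl =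
    contradiction 2∣ (∣⇒∤^+1 k (s<s z<s)
                       (∣m∣n⇒∣m+n ∣-refl (∣n⇒∣m*n a (divides 3 refl))))
  ... | result a (suc (suc (suc zero))) refl =
    contradiction 3∣ (∣⇒∤^+1 k (s<s z<s)
                       (∣m∣n⇒∣m+n ∣-refl (∣n⇒∣m*n a (divides 2 refl))))
  ... | result a (suc (suc (suc (suc zero)))) refl =
    contradiction 2∣ (∣⇒∤^+1 k (s<s z<s)
                       (∣m∣n⇒∣m+n (divides 2 refl) (∣n⇒∣m*n a (divides 3 refl))))
  ... | result a (suc (suc (suc (suc (suc zero))))) refl = a , refl
  ... | result a (suc zero) refl with ^-≡1-mod 6 a (suc k)
  ...   | e , eq =
    contradiction (subst (3 ∣_) (trans (cong (_+ 1) eq) (+-comm (1 + e * 6) 1)) 3∣)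
                  (∣m⇒∤o+m (s<s (s<s z<s)) (∣n⇒∣m*n e (divides 2 refl)))

oddPowerSum : ℕ → ℕ → ℕ
oddPowerSum y zero = 0
oddPowerSum y (suc m) = y + y * y * oddPowerSum y m

oddPower-expansion : ∀ x m →
  (1 + x) ^ (1 + m * 2) ≡ 1 + x + x * (2 + x) * oddPowerSum (1 + x) m
oddPower-expansion x zero = base x
  where
  base : ∀ x → (1 + x) * 1 ≡ 1 + x + x * (2 + x) * 0
  base = solve-∀
oddPower-expansion x (suc m) = begin
  y * (y * y ^ (1 + m * 2))         ≡⟨ cong (λ t → y * (y * t)) (oddPower-expansion x m) ⟩
  y * (y * (y + x * (2 + x) * S))   ≡⟨ step x S ⟩
  y + x * (2 + x) * (y + y * y * S) ∎
  where
  open ≡-Reasoning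
  y = 1 + x
  S = oddPowerSum y m
  step : ∀ x S → (1 + x) * ((1 + x) * (1 + x + x * (2 + x) * S))
                 ≡ 1 + x + x * (2 + x) * (1 + x + (1 + x) * (1 + x) * S)
  step = solve-∀

-- With y = 1 + x:
-- cofactor x m = (y ^ (2m + 1) + 1) / (y + 1) = y ^ 2m − y ^ (2m − 1) + ⋯ + 1.
cofactor : ℕ → ℕ → ℕ
cofactor x m = 1 + x * oddPowerSum (1 + x) m

oddPower+1-factorisation : ∀ x m → (1 + x) ^ (1 + m * 2) + 1 ≡ (2 + x) * cofactor x m
oddPower+1-factorisation x m =
  trans (cong (_+ 1) (oddPower-expansion x m)) (factor x (oddPowerSum (1 + x) m))
  where
  factor : ∀ x S → 1 + x + x * (2 + x) * S + 1 ≡ (2 + x) * (1 + x * S)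
  factor = solve-∀

cofactor-odd : ∀ {x} m → 2 ∣ x → 2 ∤ cofactor x m
cofactor-odd {x} m 2∣x = ∣m⇒∤o+m (s<s z<s) (∣m⇒∣m*n (oddPowerSum (1 + x) m) 2∣x)

3∣m+oddPowerSum : ∀ a m → 3 ∣ m + oddPowerSum (2 + a * 3) m
3∣m+oddPowerSum a zero = 3 ∣0
3∣m+oddPowerSum a (suc m) =
  subst (3 ∣_) (sym (step a m S))
    (∣m∣n⇒∣m+n (3∣m+oddPowerSum a m) (n∣m*n (1 + a + (1 + a * 4 + a * a * 3) * S)))
  where
  S = oddPowerSum (2 + a * 3) m
  step : ∀ a m S → 1 + m + (2 + a * 3 + (2 + a * 3) * (2 + a * 3) * S)
                   ≡ m + S + (1 + a + (1 + a * 4 + a * a * 3) * S) * 3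
  step = solve-∀

-- For y ≡ −1 (mod 3) the cofactor is ∑ (−y)ⁱ ≡ 2m + 1 (mod 3).
3∣cofactor⇒3∣exponent : ∀ a m → 3 ∣ cofactor (1 + a * 3) m → 3 ∣ 1 + m * 2
3∣cofactor⇒3∣exponent a m 3∣Q =
  ∣m+n∣m⇒∣n (subst (3 ∣_) (sym (identity a m S)) 3∣rhs) (∣m⇒∣m*n 2 3∣Q)
  where
  S = oddPowerSum (2 + a * 3) m
  identity : ∀ a m S → (1 + (1 + a * 3) * S) * 2 + (1 + m * 2)
                       ≡ (m + S) * 2 + (1 + a * 2 * S) * 3
  identity = solve-∀
  3∣rhs : 3 ∣ (m + S) * 2 + (1 + a * 2 * S) * 3
  3∣rhs = ∣m∣n⇒∣m+n (∣m⇒∣m*n 2 (3∣m+oddPowerSum a m)) (n∣m*n (1 + a * 2 * S))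

no-solution-cube : ∀ r s z → 2 ^ suc r * 3 ^ suc s ≢ z ^ 3 + 1
no-solution-cube r s z E
  with 6∣y^[1+k]+1⇒y≡5-mod-6 z 2 (subst (6 ∣_) E (6∣2^[1+r]*3^[1+s] r s))
... | a , refl = Q≢1 (∣2^r*3^s⇒≡1 (suc r) (suc s) 2∤Q 3∤Q Q∣N)
  where
  c = 1 + a * 3 + a * a * 2
  Q = 1 + c * 6
  cubic-cofactor : ∀ a → 1 + (4 + a * 6) * (5 + a * 6 + (5 + a * 6) * (5 + a * 6) * 0)
                         ≡ 3 * (1 + (1 + a * 3 + a * a * 2) * 6)
  cubic-cofactor = solve-∀
  Q∣N : Q ∣ 2 ^ suc r * 3 ^ suc s
  Q∣N = divides ((6 + a * 6) * 3) (begin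
    2 ^ suc r * 3 ^ suc s                ≡⟨ E ⟩
    (5 + a * 6) ^ 3 + 1                  ≡⟨ oddPower+1-factorisation (4 + a * 6) 1 ⟩
    (6 + a * 6) * cofactor (4 + a * 6) 1 ≡⟨ cong ((6 + a * 6) *_) (cubic-cofactor a) ⟩
    (6 + a * 6) * (3 * Q)                ≡⟨ sym (*-assoc (6 + a * 6) 3 Q) ⟩
    (6 + a * 6) * 3 * Q                  ∎)
    where open ≡-Reasoning
  2∤Q : 2 ∤ Q
  2∤Q = ∣m⇒∤o+m (s<s z<s) (∣n⇒∣m*n c (divides 3 refl))
  3∤Q : 3 ∤ Q
  3∤Q = ∣m⇒∤o+m (s<s z<s) (∣n⇒∣m*n c (divides 2 refl))
  Q≢1 : Q ≢ 1
  Q≢1 ()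

no-solution-3∤n : ∀ r s y m → 3 ∤ 1 + suc m * 2
                → 2 ^ suc r * 3 ^ suc s ≢ y ^ (1 + suc m * 2) + 1
no-solution-3∤n r s y m 3∤n E
  with 6∣y^[1+k]+1⇒y≡5-mod-6 y (suc m * 2) (subst (6 ∣_) E (6∣2^[1+r]*3^[1+s] r s))
... | a , refl = Q≢1 (∣2^r*3^s⇒≡1 (suc r) (suc s) 2∤Q 3∤Q Q∣N)
  where
  Q = cofactor (4 + a * 6) (suc m)
  Q∣N : Q ∣ 2 ^ suc r * 3 ^ suc s
  Q∣N = divides (6 + a * 6) (trans E (oddPower+1-factorisation (4 + a * 6) (suc m)))
  2∤Q : 2 ∤ Q
  2∤Q = cofactor-odd (suc m)
          (∣m∣n⇒∣m+n (divides 2 refl) (∣n⇒∣m*n a (divides 3 refl)))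
  3∤Q : 3 ∤ Q
  3∤Q = 3∤n ∘ 3∣cofactor⇒3∣exponent (1 + a * 2) (suc m)
            ∘ subst (λ x → 3 ∣ cofactor x (suc m)) (cong (4 +_) (sym (*-assoc a 2 3)))
  Q≢1 : Q ≢ 1
  Q≢1 ()

no-solution-even : ∀ r s y m → 2 ^ suc r * 3 ^ suc s ≢ y ^ (m * 2) + 1
no-solution-even r s y m E =
  3∤x*x+1 (y ^ m) (subst (3 ∣_) (trans E (cong (_+ 1) y^[m*2]≡y^m*y^m))
                                (∣-trans (divides 2 refl) (6∣2^[1+r]*3^[1+s] r s)))
  where
  y^[m*2]≡y^m*y^m : y ^ (m * 2) ≡ y ^ m * y ^ m
  y^[m*2]≡y^m*y^m = trans (sym (^-*-assoc y m 2)) (cong (y ^ m *_) (*-identityʳ (y ^ m)))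

lemma2p12 : ∀ (r s y n : ℕ) → 1 ≤ r → 1 ≤ s → 1 < y → 1 < n
            → ¬ (2 ^ r * 3 ^ s ≡ y ^ n + 1)
lemma2p12 (suc r) (suc s) y n _ _ _ 1<n E with n divMod 2
... | result m zero refl = no-solution-even r s y m E
... | result zero (suc zero) refl = <-irrefl refl 1<n
... | result (suc m) (suc zero) refl with 3 ∣? (1 + suc m * 2)
...   | no 3∤n = no-solution-3∤n r s y m 3∤n E
...   | yes (divides k n≡k*3) = no-solution-cube r s (y ^ k) (trans E (cong (_+ 1) y^n≡[y^k]^3))
  where
  y^n≡[y^k]^3 : y ^ (1 + suc m * 2) ≡ (y ^ k) ^ 3
  y^n≡[y^k]^3 = trans (cong (y ^_) n≡k*3) (sym (^-*-assoc y k 3))
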